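{- Let $t_1,\ldots,t_n\in\mathcal B$ and let $p_1,\ldots,p_n$ be minimal patterns such that $\mathrm{match}_{\mathcal P}(t_1,\ldots,t_n;p_1,\ldots,p_n)$ is defined and equal to $\theta$. Then for each $i$ and each $q\in p_i\theta$ there is a normal form $v$ of $t_i$ with $\mathrm{pat}(v)=q$.
   Context: Patterns $p::=\alpha\mid\mathsf{leaf}\mid\mathsf{node}(p,q)\mid\_\mid\bot$ (closed = no variables); minimal patterns: $p::=\alpha\mid\mathsf{leaf}\mid\mathsf{node}(p,q)$. Erased terms $t::=x\mid f\mid\lambda x.t\mid t\,u\mid\mathsf{Leaf}\mid\mathsf{Node}$; fix a finite set of rewrite rules, $\to$ the closure under contexts of $\beta$ and erased rule instances, $\mathcal{SN}$ the strongly normalizing erased terms. Neutral = not of the form $\lambda x.t$, $\mathsf{Node}\,t\,u$, $\mathsf{Leaf}$; a value of $t$ is a non-neutral $v$ with $t\to^*v$. $\mathcal B$ is the smallest set with $\mathcal B=\{t\in\mathcal{SN}\mid$ every value of $t$ is $\mathsf{Leaf}$ or $\mathsf{Node}\,t_1t_2$ with $t_1,t_2\in\mathcal B\}$. For a normal form $t$: $\mathrm{pat}(t)=\bot$ if $t$ neutral, $\mathrm{pat}(\mathsf{Leaf})=\mathsf{leaf}$, $\mathrm{pat}(\mathsf{Node}\,t\,u)=\mathsf{node}(\mathrm{pat}(t),\mathrm{pat}(u))$, $\mathrm{pat}(t)=\_$ otherwise. A pattern valuation is a partial finite-support map from pattern variables to non-empty sets of closed patterns; $p\theta$: $\alpha\theta=\theta(\alpha)$,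 $\mathsf{leaf}\theta=\{\mathsf{leaf}\}$, $\_\theta=\{\_\}$, $\bot\theta=\{\bot\}$, $\mathsf{node}(p_1,p_2)\theta=\{\mathsf{node}(q_1,q_2)\mid q_i\in p_i\theta\}$. The partial function $\mathrm{match}_{\mathcal P}(t_1,\ldots,t_n;p_1,\ldots,p_n)$: if all $p_i$ are variables $\alpha_i$ and $t_i=t_j$ whenever $\alpha_i=\alpha_j$, it is the valuation $\alpha_i\mapsto\{\mathrm{pat}(v)\mid v$ normal form of $t_i\}$; if some $p_i=\mathsf{node}(q_1,q_2)$ and $t_i=\mathsf{Node}\,u_1u_2$, it is $\mathrm{match}_{\mathcal P}$ of the lists with $t_i$ replaced by $u_1,u_2$ and $p_i$ by $q_1,q_2$; if some $p_i=\mathsf{leaf}$ and $t_i=\mathsf{Leaf}$, it is $\mathrm{match}_{\mathcal P}$ of the lists with the $i$-th entries removed; otherwise undefined. -}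

module Defs where

open import Data.Nat using (ℕ; zero; suc)
open import Data.List using (List; []; _∷_; _++_; foldl; map)
open import Data.List.Membership.Propositional using (_∈_)
open import Data.Product using (Σ; _×_; _,_)
open import Data.Sum using (_⊎_)
open import Data.Empty using (⊥)
open import Relation.Nullary using (¬_)
open import Relation.Binary.PropositionalEquality using (_≡_)
open import Relation.Binary.Construct.Closure.ReflexiveTransitive using (Star)

-- Erased terms (de Bruijn indices for variables, ℕ-named function symbols)
--   t ::= x | f | λx.t | t u | Leaf | Node

data Tm : Set where
  var  : ℕ → Tm
  fun  : ℕ → Tm
  lam  : Tm → Tm
  app  : Tm → Tm → Tm
  Leaf : Tm
  Nd   : Tm

Node : Tm → Tm → Tm
Node t u = app (app Nd t) u

ext : (ℕ → ℕ) → ℕ → ℕ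
ext ρ zero    = zero
ext ρ (suc n) = suc (ρ n)

rename : (ℕ → ℕ) → Tm → Tm
rename ρ (var x)   = var (ρ x)
rename ρ (fun f)   = fun f
rename ρ (lam t)   = lam (rename (ext ρ) t)
rename ρ (app t u) = app (rename ρ t) (rename ρ u)
rename ρ Leaf      = Leaf
rename ρ Nd        = Nd

exts : (ℕ → Tm) → ℕ → Tm
exts σ zero    = var zero
exts σ (suc n) = rename suc (σ n)

subst : (ℕ → Tm) → Tm → Tm
subst σ (var x)   = σ x
subst σ (fun f)   = fun f
subst σ (lam t)   = lam (subst (exts σ) t)
subst σ (app t u) = app (subst σ t) (subst σ u)
subst σ Leaf      = Leaf
subst σ Nd        = Nd

single : Tm → ℕ → Tm
single u zero    = u
single u (suc n) = var n

_[_] : Tm → Tm → Tm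
t [ u ] = subst (single u) t

-- Erased rewrite rules  f l₁ … lₖ → r  (free variables of the rule are
-- the de Bruijn variables, instantiated by a substitution)

record Rule : Set where
  field
    sym  : ℕ
    args : List Tm
    rhs  : Tm

lhs : Rule → Tm
lhs r = foldl app (fun (Rule.sym r)) (Rule.args r)

data _⊢_⟶_ (R : List Rule) : Tm → Tm → Set where
  beta : ∀ {t u} → R ⊢ app (lam t) u ⟶ (t [ u ])
  rule : ∀ {r} → r ∈ R → (σ : ℕ → Tm) → R ⊢ subst σ (lhs r) ⟶ subst σ (Rule.rhs r)
  appL : ∀ {t t' u} → R ⊢ t ⟶ t' → R ⊢ app t u ⟶ app t' u
  appR : ∀ {t u u'} → R ⊢ u ⟶ u' → R ⊢ app t u ⟶ app t u'
  lamC : ∀ {t t'} → R ⊢ t ⟶ t' → R ⊢ lam t ⟶ lam t'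

_⊢_⟶*_ : List Rule → Tm → Tm → Set
R ⊢ t ⟶* u = Star (R ⊢_⟶_) t u

data SN (R : List Rule) (t : Tm) : Set where
  sn : (∀ u → R ⊢ t ⟶ u → SN R u) → SN R t

NormalForm : List Rule → Tm → Set
NormalForm R t = ∀ u → ¬ (R ⊢ t ⟶ u)

NormalFormOf : List Rule → Tm → Tm → Set
NormalFormOf R t v = (R ⊢ t ⟶* v) × NormalForm R v

data NonNeutral : Tm → Set where
  nnLam  : ∀ t → NonNeutral (lam t)
  nnNode : ∀ t u → NonNeutral (Node t u)
  nnLeaf : NonNeutral Leaf

Neutral : Tm → Set
Neutral t = ¬ NonNeutral t

ValueOf : List Rule → Tm → Tm → Set
ValueOf R t v = NonNeutral v × (R ⊢ t ⟶* v)

data 𝓑 (R : List Rule) (t : Tm) : Set where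
  mk𝓑 : SN R t →
        (∀ v → ValueOf R t v →
           (v ≡ Leaf) ⊎ Σ Tm (λ t₁ → Σ Tm (λ t₂ → (v ≡ Node t₁ t₂) × 𝓑 R t₁ × 𝓑 R t₂))) →
        𝓑 R t

data Pat : Set where
  pv   : ℕ → Pat
  leaf : Pat
  node : Pat → Pat → Pat
  wild : Pat
  bot  : Pat

data Minimal : Pat → Set where
  mVar  : ∀ α → Minimal (pv α)
  mLeaf : Minimal leaf
  mNode : ∀ {p q} → Minimal p → Minimal q → Minimal (node p q)

-- pat(t) (meaningful for normal forms t)
pat : Tm → Pat
pat (lam t)           = wild
pat Leaf              = leaf
pat (app (app Nd t) u) = node (pat t) (pat u)
pat _                 = bot

-- pattern valuations: α ↦ set of (closed) patterns, given as a predicate;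
-- α outside the domain is mapped to the empty predicate
Valuation : Set₁
Valuation = ℕ → Pat → Set

_∈⟦_⟧_ : Pat → Pat → Valuation → Set
q ∈⟦ pv α ⟧ θ     = θ α q
q ∈⟦ leaf ⟧ θ     = q ≡ leaf
q ∈⟦ wild ⟧ θ     = q ≡ wild
q ∈⟦ bot ⟧ θ      = q ≡ bot
q ∈⟦ node p₁ p₂ ⟧ θ =
  Σ Pat (λ q₁ → Σ Pat (λ q₂ → (q ≡ node q₁ q₂) × (q₁ ∈⟦ p₁ ⟧ θ) × (q₂ ∈⟦ p₂ ⟧ θ)))

-- match_𝒫 as the graph of the (partial) function, on the list of pairs (tᵢ , pᵢ)

baseVal : List Rule → List (Tm × ℕ) → Valuation
baseVal R xs α q = Σ Tm (λ t → ((t , α) ∈ xs) ×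
                     Σ Tm (λ v → NormalFormOf R t v × (pat v ≡ q)))

varPairs : List (Tm × ℕ) → List (Tm × Pat)
varPairs = map (λ { (t , α) → (t , pv α) })

data Match (R : List Rule) : List (Tm × Pat) → Valuation → Set₁ where
  mBase : (xs : List (Tm × ℕ)) →
          (∀ {t t' α} → (t , α) ∈ xs → (t' , α) ∈ xs → t ≡ t') →
          Match R (varPairs xs) (baseVal R xs)
  mNode : ∀ {θ} pre post u₁ u₂ q₁ q₂ →
          Match R (pre ++ (u₁ , q₁) ∷ (u₂ , q₂) ∷ post) θ →
          Match R (pre ++ (Node u₁ u₂ , node q₁ q₂) ∷ post) θ
  mLeaf : ∀ {θ} pre post →
          Match R (pre ++ post) θ →
          Match R (pre ++ (Leaf , leaf) ∷ post) θ

-- In the base case the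
-- valuation of α is, by construction, the set of patterns of the normal
-- forms of the (unique) term matched against α. A leaf is realised by the
-- normal form Leaf of Leaf, and node(q₁, q₂) by Node v₁ v₂ for normal forms
-- vᵢ of uᵢ realising qᵢ: Node v₁ v₂ is normal because rule left-hand sides
-- are headed by a function symbol, never by the constructor Node.
module Submission where

open import Defs
open import Data.Nat using (ℕ)
open import Data.Fin using (Fin)
open import Data.Vec using (Vec; lookup; zip; toList)
open import Data.Vec.Properties using (lookup-zipWith)
open import Data.Vec.Membership.Propositional.Properties using (∈-lookup; ∈-toList⁺)
open import Data.List using (List; []; _∷_; foldl)
open import Data.List.Membership.Propositional using (_∈_)
open import Data.List.Relation.Unary.All as All using (All; _∷_)
open import Data.List.Relation.Unary.All.Properties using (++⁺; ++⁻; map⁺)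
open import Data.Product using (Σ; _×_; _,_)
open import Data.Empty using (⊥)
open import Relation.Binary.PropositionalEquality using (_≡_; refl)
import Relation.Binary.PropositionalEquality as ≡
open import Relation.Binary.Construct.Closure.ReflexiveTransitive using (ε; _◅◅_; gmap)

data FunHeaded : Tm → Set where
  fun : ∀ f → FunHeaded (fun f)
  app : ∀ {t u} → FunHeaded t → FunHeaded (app t u)

foldl-app-FunHeaded : ∀ {t} us → FunHeaded t → FunHeaded (foldl app t us)
foldl-app-FunHeaded []       h = h
foldl-app-FunHeaded (u ∷ us) h = foldl-app-FunHeaded us (app h)

subst-FunHeaded : ∀ σ {t} → FunHeaded t → FunHeaded (subst σ t)
subst-FunHeaded σ (fun f) = fun f
subst-FunHeaded σ (app h) = app (subst-FunHeaded σ h)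

rule-instance-FunHeaded : ∀ r σ → FunHeaded (subst σ (lhs r))
rule-instance-FunHeaded r σ = subst-FunHeaded σ (foldl-app-FunHeaded (Rule.args r) (fun _))

module _ {R : List Rule} where

  data NormalConstructorSpine : Tm → Set where
    Leaf : NormalConstructorSpine Leaf
    Nd   : NormalConstructorSpine Nd
    app  : ∀ {t u} → NormalConstructorSpine t → NormalForm R u →
           NormalConstructorSpine (app t u)

  FunHeaded-not-constructorSpine : ∀ {t} → FunHeaded t → NormalConstructorSpine t → ⊥
  FunHeaded-not-constructorSpine (app h) (app s _) = FunHeaded-not-constructorSpine h s

  constructorSpine-normal : ∀ {t} → NormalConstructorSpine t → NormalForm R t
  constructorSpine-normal s _ (rule {r} _ σ) =
    FunHeaded-not-constructorSpine (rule-instance-FunHeaded r σ) s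
  constructorSpine-normal (app () _) _ beta
  constructorSpine-normal (app s _)  _ (appL t⟶) = constructorSpine-normal s _ t⟶
  constructorSpine-normal (app _ nf) _ (appR u⟶) = nf _ u⟶

  Leaf-normalFormOf : NormalFormOf R Leaf Leaf
  Leaf-normalFormOf = ε , constructorSpine-normal Leaf

  Node-normalFormOf : ∀ {t₁ t₂ v₁ v₂} → NormalFormOf R t₁ v₁ → NormalFormOf R t₂ v₂ →
                      NormalFormOf R (Node t₁ t₂) (Node v₁ v₂)
  Node-normalFormOf {t₂ = t₂} {v₁} (t₁⟶*v₁ , nf₁) (t₂⟶*v₂ , nf₂) =
    gmap (λ t → app t t₂) appL (gmap (app Nd) appR t₁⟶*v₁) ◅◅ gmap (app (app Nd v₁)) appR t₂⟶*v₂ ,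
    constructorSpine-normal (app (app Nd nf₁) nf₂)

  Realised : Valuation → Tm × Pat → Set
  Realised θ (t , p) = ∀ q → q ∈⟦ p ⟧ θ → Σ Tm (λ v → NormalFormOf R t v × (pat v ≡ q))

  leaf-realised : ∀ {θ} → Realised θ (Leaf , leaf)
  leaf-realised _ refl = Leaf , Leaf-normalFormOf , refl

  node-realised : ∀ {θ u₁ u₂ p₁ p₂} → Realised θ (u₁ , p₁) → Realised θ (u₂ , p₂) →
                  Realised θ (Node u₁ u₂ , node p₁ p₂)
  node-realised real₁ real₂ _ (q₁ , q₂ , refl , q₁∈ , q₂∈)
    with real₁ q₁ q₁∈ | real₂ q₂ q₂∈
  ... | v₁ , nf₁ , refl | v₂ , nf₂ , refl = Node v₁ v₂ , Node-normalFormOf nf₁ nf₂ , refl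

  baseVal-realised : ∀ xs → (∀ {t t' α} → (t , α) ∈ xs → (t' , α) ∈ xs → t ≡ t') →
                     All (Realised (baseVal R xs)) (varPairs xs)
  baseVal-realised xs functional = map⁺ (All.tabulate realise)
    where
    realise : ∀ {t α} → (t , α) ∈ xs → Realised (baseVal R xs) (t , pv α)
    realise t∈ _ (t' , t'∈ , v , nf , pat-v) with functional t∈ t'∈
    ... | refl = v , nf , pat-v

  match-realised : ∀ {xs θ} → Match R xs θ → All (Realised θ) xs
  match-realised (mBase xs functional) = baseVal-realised xs functional
  match-realised (mNode pre post u₁ u₂ q₁ q₂ M) with ++⁻ pre (match-realised M)
  ... | realPre , real₁ ∷ real₂ ∷ realPost =
    ++⁺ realPre (node-realised {p₁ = q₁} {q₂} real₁ real₂ ∷ realPost)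
  match-realised {θ = θ} (mLeaf pre post M) with ++⁻ pre (match-realised M)
  ... | realPre , realPost = ++⁺ realPre (leaf-realised {θ} ∷ realPost)

zip-lookup-∈ : ∀ {n} (ts : Vec Tm n) (ps : Vec Pat n) i →
               (lookup ts i , lookup ps i) ∈ toList (zip ts ps)
zip-lookup-∈ ts ps i =
  ≡.subst (_∈ toList (zip ts ps)) (lookup-zipWith _,_ i ts ps) (∈-toList⁺ (∈-lookup i (zip ts ps)))

mainTheorem11 : (R : List Rule) (n : ℕ) (ts : Vec Tm n) (ps : Vec Pat n) (θ : Valuation) →
    (∀ i → 𝓑 R (lookup ts i)) →
    (∀ i → Minimal (lookup ps i)) →
    Match R (toList (zip ts ps)) θ →
    ∀ (i : Fin n) (q : Pat) → q ∈⟦ lookup ps i ⟧ θ →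
    Σ Tm (λ v → NormalFormOf R (lookup ts i) v × (pat v ≡ q))
mainTheorem11 R n ts ps θ _ _ M i = All.lookup (match-realised M) (zip-lookup-∈ ts ps i)
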